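{- Let $M\mapsto M^*$ be the translation from the untyped monadic reflection calculus to the untyped delimited control calculus that is homomorphic on all core constructs and satisfies $(\mathtt{reflect}\,M)^*=\mathcal{S}_0k.\lambda b.\,b!\,(\{M^*\},\{\lambda x.\,k!\,x\,b\})$ and $(\mathtt{reify}_{T}\,M)^*=\langle M^*\mid x.\lambda b.N_u^*\rangle\,\{\lambda(y,f).N_b^*\}$ for $T=\mathtt{where}\{\mathtt{return}\,x=N_u;\ y\gg\!=f=N_b\}$ (with $b,k$ fresh, and $\lambda(y,f).P$ abbreviating $\lambda w.\,\mathtt{let}\,(y,f)=w\,\mathtt{in}\,P$ for fresh $w$). Then for all computations $M,N$ of the monadic reflection calculus, $M\to N$ implies $M^*\rightsquigarrow^{+}N^*$.
   Context: Core syntax (shared). Values $V ::= x \mid () \mid (V_1,V_2) \mid \ell\,V \mid \{M\}$; computations $M,N ::= \mathtt{let}\,(x,y)=V\,\mathtt{in}\,M \mid \mathtt{case}\,V\,\mathtt{of}\,\{\ell_i x_i\mapsto M_i\}_i \mid V! \mid \mathtt{return}\,V \mid \mathtt{let}\,x\Leftarrow M\,\mathtt{in}\,N \mid \lambda x.M \mid M\,V \mid \langle M_1,M_2\rangle \mid \mathrm{prj}_i M$. Core $\beta$-rules: $\mathtt{let}\,(x,y)=(V_1,V_2)\,\mathtt{in}\,M \to_\beta M[V_1/x,V_2/y]$; $\mathtt{case}\,\ell_j V\,\mathtt{of}\,\{\dots\ell_j x_j\mapsto M_j\dots\}\to_\beta M_j[V/x_j]$; $\{M\}!\to_\beta M$;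 $\mathtt{let}\,x\Leftarrow\mathtt{return}\,V\,\mathtt{in}\,N\to_\beta N[V/x]$; $(\lambda x.M)V\to_\beta M[V/x]$; $\mathrm{prj}_i\langle M_1,M_2\rangle\to_\beta M_i$. Basic frames $B ::= \mathtt{let}\,x\Leftarrow[\,]\,\mathtt{in}\,N\mid[\,]\,V\mid\mathrm{prj}_i[\,]$; hoisting contexts $\mathcal{H}::=[\,]\mid\mathcal{H}[B]$. In each calculus $M\to N$ iff $M=K[M']$, $N=K[N']$ with $M'\to_\beta N'$ and $K$ an evaluation context of that calculus. Monadic reflection calculus: monad terms $T=\mathtt{where}\{\mathtt{return}\,x=N_u;\ y\gg\!=f=N_b\}$; adds computations $\mathtt{reflect}\,N$ and $\mathtt{reify}_T\,M$; evaluation contexts $K::=[\,]\mid K[B]\mid K[\mathtt{reify}_T[\,]]$; extra rules $\mathtt{reify}_T(\mathtt{return}\,V)\to_\beta N_u[V/x]$ and $\mathtt{reify}_T\,\mathcal{H}[\mathtt{reflect}\,N]\to_\beta N_b[\{N\}/y,\{\lambda z.\mathtt{reify}_T\,\mathcal{H}[\mathtt{return}\,z]\}/f]$. Delimited control calculus: adds computations $\mathcal{S}_0k.M$ and $\langle M\mid x.N\rangle$; evaluation contexts $K::=[\,]\mid K[B]\mid K[\langle[\,]\mid x.N\rangle]$; extra rules $\langle\mathtt{return}\,V\mid x.N\rangle\to_\beta N[V/x]$ and $\langle\mathcal{H}[\mathcal{S}_0k.M]\mid x.N\rangle\to_\beta M[\{\lambda y.\langle\mathcal{H}[\mathtt{return}\,y]\mid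 x.N\rangle\}/k]$. $\rightsquigarrow$ is the smallest relation on terms of the target calculus containing $\to_\beta$ and closed under all term-forming constructs; $\rightsquigarrow^{+}$ is its transitive closure. -}

module Defs where

-- Conventions:
--  * a term of scope n has free variables Fin n; the most recently bound
--    variable is index zero.
--  * let (x,y) = V in M : M has scope 2+n, y = zero, x = suc zero.
--  * monad term where{return x = Nu; y >>= f = Nb}:
--      Nu has scope 1+n (x = zero);  Nb has scope 2+n (f = zero, y = suc zero).
--  * labels are natural numbers; case picks the first branch with matching label.

open import Data.Nat using (ℕ; zero; suc)
open import Data.Fin using (Fin; zero; suc)
open import Relation.Binary.PropositionalEquality using (_≡_; _≢_)
open import Relation.Binary.Construct.Closure.Transitive using (TransClosure)

Label : Set
Label = ℕ

module MR where

  mutual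
    data Val (n : ℕ) : Set where
      var   : Fin n → Val n
      unit  : Val n
      pair  : Val n → Val n → Val n
      inj   : Label → Val n → Val n
      thunk : Comp n → Val n

    data Comp (n : ℕ) : Set where
      letpair : Val n → Comp (suc (suc n)) → Comp n
      case    : Val n → Branches n → Comp n
      force   : Val n → Comp n
      return  : Val n → Comp n
      letbind : Comp n → Comp (suc n) → Comp n
      lam     : Comp (suc n) → Comp n
      app     : Comp n → Val n → Comp n
      cpair   : Comp n → Comp n → Comp n
      prj₁    : Comp n → Comp n
      prj₂    : Comp n → Comp n
      reflect : Comp n → Comp n
      reify   : Monad n → Comp n → Comp n

    data Branches (n : ℕ) : Set where
      []    : Branches n
      _↦_∷_ : Label → Comp (suc n) → Branches n → Branches n

    data Monad (n : ℕ) : Set where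
      where' : (Nu : Comp (suc n)) → (Nb : Comp (suc (suc n))) → Monad n

  Ren : ℕ → ℕ → Set
  Ren n m = Fin n → Fin m

  liftR : ∀ {n m} → Ren n m → Ren (suc n) (suc m)
  liftR ρ zero    = zero
  liftR ρ (suc i) = suc (ρ i)

  mutual
    renV : ∀ {n m} → Ren n m → Val n → Val m
    renV ρ (var i)   = var (ρ i)
    renV ρ unit      = unit
    renV ρ (pair V W) = pair (renV ρ V) (renV ρ W)
    renV ρ (inj l V) = inj l (renV ρ V)
    renV ρ (thunk M) = thunk (renC ρ M)

    renC : ∀ {n m} → Ren n m → Comp n → Comp m
    renC ρ (letpair V M) = letpair (renV ρ V) (renC (liftR (liftR ρ)) M)
    renC ρ (case V bs)   = case (renV ρ V) (renB ρ bs)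
    renC ρ (force V)     = force (renV ρ V)
    renC ρ (return V)    = return (renV ρ V)
    renC ρ (letbind M N) = letbind (renC ρ M) (renC (liftR ρ) N)
    renC ρ (lam M)       = lam (renC (liftR ρ) M)
    renC ρ (app M V)     = app (renC ρ M) (renV ρ V)
    renC ρ (cpair M N)   = cpair (renC ρ M) (renC ρ N)
    renC ρ (prj₁ M)      = prj₁ (renC ρ M)
    renC ρ (prj₂ M)      = prj₂ (renC ρ M)
    renC ρ (reflect M)   = reflect (renC ρ M)
    renC ρ (reify T M)   = reify (renT ρ T) (renC ρ M)

    renB : ∀ {n m} → Ren n m → Branches n → Branches m
    renB ρ []             = []
    renB ρ (l ↦ M ∷ bs)   = l ↦ renC (liftR ρ) M ∷ renB ρ bs

    renT : ∀ {n m} → Ren n m → Monad n → Monad m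
    renT ρ (where' Nu Nb) = where' (renC (liftR ρ) Nu) (renC (liftR (liftR ρ)) Nb)

  Sub : ℕ → ℕ → Set
  Sub n m = Fin n → Val m

  liftS : ∀ {n m} → Sub n m → Sub (suc n) (suc m)
  liftS σ zero    = var zero
  liftS σ (suc i) = renV suc (σ i)

  mutual
    subV : ∀ {n m} → Sub n m → Val n → Val m
    subV σ (var i)    = σ i
    subV σ unit       = unit
    subV σ (pair V W) = pair (subV σ V) (subV σ W)
    subV σ (inj l V)  = inj l (subV σ V)
    subV σ (thunk M)  = thunk (subC σ M)

    subC : ∀ {n m} → Sub n m → Comp n → Comp m
    subC σ (letpair V M) = letpair (subV σ V) (subC (liftS (liftS σ)) M)
    subC σ (case V bs)   = case (subV σ V) (subB σ bs)
    subC σ (force V)     = force (subV σ V)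
    subC σ (return V)    = return (subV σ V)
    subC σ (letbind M N) = letbind (subC σ M) (subC (liftS σ) N)
    subC σ (lam M)       = lam (subC (liftS σ) M)
    subC σ (app M V)     = app (subC σ M) (subV σ V)
    subC σ (cpair M N)   = cpair (subC σ M) (subC σ N)
    subC σ (prj₁ M)      = prj₁ (subC σ M)
    subC σ (prj₂ M)      = prj₂ (subC σ M)
    subC σ (reflect M)   = reflect (subC σ M)
    subC σ (reify T M)   = reify (subT σ T) (subC σ M)

    subB : ∀ {n m} → Sub n m → Branches n → Branches m
    subB σ []           = []
    subB σ (l ↦ M ∷ bs) = l ↦ subC (liftS σ) M ∷ subB σ bs

    subT : ∀ {n m} → Sub n m → Monad n → Monad m
    subT σ (where' Nu Nb) = where' (subC (liftS σ) Nu) (subC (liftS (liftS σ)) Nb)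

  sub1 : ∀ {n} → Val n → Sub (suc n) n
  sub1 V zero    = V
  sub1 V (suc i) = var i

  sub2 : ∀ {n} → Val n → Val n → Sub (suc (suc n)) n
  sub2 V₁ V₂ zero          = V₂
  sub2 V₁ V₂ (suc zero)    = V₁
  sub2 V₁ V₂ (suc (suc i)) = var i

  _[_]₁ : ∀ {n} → Comp (suc n) → Val n → Comp n
  M [ V ]₁ = subC (sub1 V) M

  _[_,_]₂ : ∀ {n} → Comp (suc (suc n)) → Val n → Val n → Comp n
  M [ V₁ , V₂ ]₂ = subC (sub2 V₁ V₂) M

  data _∋_↦_ {n} : Branches n → Label → Comp (suc n) → Set where
    here  : ∀ {l M bs} → (l ↦ M ∷ bs) ∋ l ↦ M
    there : ∀ {l l′ M M′ bs} → l′ ≢ l → bs ∋ l ↦ M → (l′ ↦ M′ ∷ bs) ∋ l ↦ M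

  data Frame (n : ℕ) : Set where
    letF  : Comp (suc n) → Frame n
    appF  : Val n → Frame n
    prj₁F : Frame n
    prj₂F : Frame n

  plugF : ∀ {n} → Frame n → Comp n → Comp n
  plugF (letF N) M = letbind M N
  plugF (appF V) M = app M V
  plugF prj₁F    M = prj₁ M
  plugF prj₂F    M = prj₂ M

  renF : ∀ {n m} → Ren n m → Frame n → Frame m
  renF ρ (letF N) = letF (renC (liftR ρ) N)
  renF ρ (appF V) = appF (renV ρ V)
  renF ρ prj₁F    = prj₁F
  renF ρ prj₂F    = prj₂F

  data Hoist (n : ℕ) : Set where
    hole : Hoist n
    _▷_  : Hoist n → Frame n → Hoist n

  plugH : ∀ {n} → Hoist n → Comp n → Comp n
  plugH hole    M = M
  plugH (H ▷ B) M = plugH H (plugF B M)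

  renH : ∀ {n m} → Ren n m → Hoist n → Hoist m
  renH ρ hole    = hole
  renH ρ (H ▷ B) = renH ρ H ▷ renF ρ B

  data ECtx (n : ℕ) : Set where
    hole   : ECtx n
    _▷_    : ECtx n → Frame n → ECtx n
    _▷rf_  : ECtx n → Monad n → ECtx n

  plugK : ∀ {n} → ECtx n → Comp n → Comp n
  plugK hole     M = M
  plugK (K ▷ B)  M = plugK K (plugF B M)
  plugK (K ▷rf T) M = plugK K (reify T M)

  infix 4 _→β_ _⟶_
  data _→β_ {n} : Comp n → Comp n → Set where
    β-let    : ∀ {V₁ V₂ M} → letpair (pair V₁ V₂) M →β M [ V₁ , V₂ ]₂
    β-case   : ∀ {l V bs M} → bs ∋ l ↦ M → case (inj l V) bs →β M [ V ]₁
    β-force  : ∀ {M} → force (thunk M) →β M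
    β-ret    : ∀ {V N} → letbind (return V) N →β N [ V ]₁
    β-lam    : ∀ {M V} → app (lam M) V →β M [ V ]₁
    β-prj₁   : ∀ {M₁ M₂} → prj₁ (cpair M₁ M₂) →β M₁
    β-prj₂   : ∀ {M₁ M₂} → prj₂ (cpair M₁ M₂) →β M₂
    β-reifyR : ∀ {Nu Nb V} → reify (where' Nu Nb) (return V) →β Nu [ V ]₁
    β-reifyS : ∀ {Nu Nb} (H : Hoist n) {N} →
      reify (where' Nu Nb) (plugH H (reflect N)) →β
        Nb [ thunk N
           , thunk (lam (reify (renT suc (where' Nu Nb))
                               (plugH (renH suc H) (return (var zero))))) ]₂

  data _⟶_ {n} : Comp n → Comp n → Set where
    step : ∀ (K : ECtx n) {M N} → M →β N → plugK K M ⟶ plugK K N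

module DC where

  mutual
    data Val (n : ℕ) : Set where
      var   : Fin n → Val n
      unit  : Val n
      pair  : Val n → Val n → Val n
      inj   : Label → Val n → Val n
      thunk : Comp n → Val n

    data Comp (n : ℕ) : Set where
      letpair : Val n → Comp (suc (suc n)) → Comp n
      case    : Val n → Branches n → Comp n
      force   : Val n → Comp n
      return  : Val n → Comp n
      letbind : Comp n → Comp (suc n) → Comp n
      lam     : Comp (suc n) → Comp n
      app     : Comp n → Val n → Comp n
      cpair   : Comp n → Comp n → Comp n
      prj₁    : Comp n → Comp n
      prj₂    : Comp n → Comp n
      shift0  : Comp (suc n) → Comp n                -- S₀k.M  (k = index zero)
      handle  : Comp n → Comp (suc n) → Comp n       -- ⟨M | x.N⟩ (x = index zero)

    data Branches (n : ℕ) : Set where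
      []    : Branches n
      _↦_∷_ : Label → Comp (suc n) → Branches n → Branches n

  Ren : ℕ → ℕ → Set
  Ren n m = Fin n → Fin m

  liftR : ∀ {n m} → Ren n m → Ren (suc n) (suc m)
  liftR ρ zero    = zero
  liftR ρ (suc i) = suc (ρ i)

  mutual
    renV : ∀ {n m} → Ren n m → Val n → Val m
    renV ρ (var i)    = var (ρ i)
    renV ρ unit       = unit
    renV ρ (pair V W) = pair (renV ρ V) (renV ρ W)
    renV ρ (inj l V)  = inj l (renV ρ V)
    renV ρ (thunk M)  = thunk (renC ρ M)

    renC : ∀ {n m} → Ren n m → Comp n → Comp m
    renC ρ (letpair V M) = letpair (renV ρ V) (renC (liftR (liftR ρ)) M)
    renC ρ (case V bs)   = case (renV ρ V) (renB ρ bs)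
    renC ρ (force V)     = force (renV ρ V)
    renC ρ (return V)    = return (renV ρ V)
    renC ρ (letbind M N) = letbind (renC ρ M) (renC (liftR ρ) N)
    renC ρ (lam M)       = lam (renC (liftR ρ) M)
    renC ρ (app M V)     = app (renC ρ M) (renV ρ V)
    renC ρ (cpair M N)   = cpair (renC ρ M) (renC ρ N)
    renC ρ (prj₁ M)      = prj₁ (renC ρ M)
    renC ρ (prj₂ M)      = prj₂ (renC ρ M)
    renC ρ (shift0 M)    = shift0 (renC (liftR ρ) M)
    renC ρ (handle M N)  = handle (renC ρ M) (renC (liftR ρ) N)

    renB : ∀ {n m} → Ren n m → Branches n → Branches m
    renB ρ []           = []
    renB ρ (l ↦ M ∷ bs) = l ↦ renC (liftR ρ) M ∷ renB ρ bs

  Sub : ℕ → ℕ → Set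
  Sub n m = Fin n → Val m

  liftS : ∀ {n m} → Sub n m → Sub (suc n) (suc m)
  liftS σ zero    = var zero
  liftS σ (suc i) = renV suc (σ i)

  mutual
    subV : ∀ {n m} → Sub n m → Val n → Val m
    subV σ (var i)    = σ i
    subV σ unit       = unit
    subV σ (pair V W) = pair (subV σ V) (subV σ W)
    subV σ (inj l V)  = inj l (subV σ V)
    subV σ (thunk M)  = thunk (subC σ M)

    subC : ∀ {n m} → Sub n m → Comp n → Comp m
    subC σ (letpair V M) = letpair (subV σ V) (subC (liftS (liftS σ)) M)
    subC σ (case V bs)   = case (subV σ V) (subB σ bs)
    subC σ (force V)     = force (subV σ V)
    subC σ (return V)    = return (subV σ V)
    subC σ (letbind M N) = letbind (subC σ M) (subC (liftS σ) N)
    subC σ (lam M)       = lam (subC (liftS σ) M)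
    subC σ (app M V)     = app (subC σ M) (subV σ V)
    subC σ (cpair M N)   = cpair (subC σ M) (subC σ N)
    subC σ (prj₁ M)      = prj₁ (subC σ M)
    subC σ (prj₂ M)      = prj₂ (subC σ M)
    subC σ (shift0 M)    = shift0 (subC (liftS σ) M)
    subC σ (handle M N)  = handle (subC σ M) (subC (liftS σ) N)

    subB : ∀ {n m} → Sub n m → Branches n → Branches m
    subB σ []           = []
    subB σ (l ↦ M ∷ bs) = l ↦ subC (liftS σ) M ∷ subB σ bs

  sub1 : ∀ {n} → Val n → Sub (suc n) n
  sub1 V zero    = V
  sub1 V (suc i) = var i

  sub2 : ∀ {n} → Val n → Val n → Sub (suc (suc n)) n
  sub2 V₁ V₂ zero          = V₂
  sub2 V₁ V₂ (suc zero)    = V₁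
  sub2 V₁ V₂ (suc (suc i)) = var i

  _[_]₁ : ∀ {n} → Comp (suc n) → Val n → Comp n
  M [ V ]₁ = subC (sub1 V) M

  _[_,_]₂ : ∀ {n} → Comp (suc (suc n)) → Val n → Val n → Comp n
  M [ V₁ , V₂ ]₂ = subC (sub2 V₁ V₂) M

  data _∋_↦_ {n} : Branches n → Label → Comp (suc n) → Set where
    here  : ∀ {l M bs} → (l ↦ M ∷ bs) ∋ l ↦ M
    there : ∀ {l l′ M M′ bs} → l′ ≢ l → bs ∋ l ↦ M → (l′ ↦ M′ ∷ bs) ∋ l ↦ M

  data Frame (n : ℕ) : Set where
    letF  : Comp (suc n) → Frame n
    appF  : Val n → Frame n
    prj₁F : Frame n
    prj₂F : Frame n

  plugF : ∀ {n} → Frame n → Comp n → Comp n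
  plugF (letF N) M = letbind M N
  plugF (appF V) M = app M V
  plugF prj₁F    M = prj₁ M
  plugF prj₂F    M = prj₂ M

  renF : ∀ {n m} → Ren n m → Frame n → Frame m
  renF ρ (letF N) = letF (renC (liftR ρ) N)
  renF ρ (appF V) = appF (renV ρ V)
  renF ρ prj₁F    = prj₁F
  renF ρ prj₂F    = prj₂F

  data Hoist (n : ℕ) : Set where
    hole : Hoist n
    _▷_  : Hoist n → Frame n → Hoist n

  plugH : ∀ {n} → Hoist n → Comp n → Comp n
  plugH hole    M = M
  plugH (H ▷ B) M = plugH H (plugF B M)

  renH : ∀ {n m} → Ren n m → Hoist n → Hoist m
  renH ρ hole    = hole
  renH ρ (H ▷ B) = renH ρ H ▷ renF ρ B

  data ECtx (n : ℕ) : Set where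
    hole  : ECtx n
    _▷_   : ECtx n → Frame n → ECtx n
    _▷h_  : ECtx n → Comp (suc n) → ECtx n

  plugK : ∀ {n} → ECtx n → Comp n → Comp n
  plugK hole     M = M
  plugK (K ▷ B)  M = plugK K (plugF B M)
  plugK (K ▷h N) M = plugK K (handle M N)

  infix 4 _→β_ _⟶_ _⇝_ _⇝v_ _⇝b_ _⇝⁺_
  data _→β_ {n} : Comp n → Comp n → Set where
    β-let    : ∀ {V₁ V₂ M} → letpair (pair V₁ V₂) M →β M [ V₁ , V₂ ]₂
    β-case   : ∀ {l V bs M} → bs ∋ l ↦ M → case (inj l V) bs →β M [ V ]₁
    β-force  : ∀ {M} → force (thunk M) →β M
    β-ret    : ∀ {V N} → letbind (return V) N →β N [ V ]₁
    β-lam    : ∀ {M V} → app (lam M) V →β M [ V ]₁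
    β-prj₁   : ∀ {M₁ M₂} → prj₁ (cpair M₁ M₂) →β M₁
    β-prj₂   : ∀ {M₁ M₂} → prj₂ (cpair M₁ M₂) →β M₂
    β-hdlR   : ∀ {V N} → handle (return V) N →β N [ V ]₁
    β-hdlS   : ∀ (H : Hoist n) {M N} →
      handle (plugH H (shift0 M)) N →β
        M [ thunk (lam (handle (plugH (renH suc H) (return (var zero)))
                               (renC (liftR suc) N))) ]₁

  data _⟶_ {n} : Comp n → Comp n → Set where
    step : ∀ (K : ECtx n) {M N} → M →β N → plugK K M ⟶ plugK K N

  mutual
    data _⇝_ : ∀ {n} → Comp n → Comp n → Set where
      β        : ∀ {n} {M N : Comp n} → M →β N → M ⇝ N
      letpairV : ∀ {n} {V V′ : Val n} {M} → V ⇝v V′ → letpair V M ⇝ letpair V′ M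
      letpairM : ∀ {n} {V : Val n} {M M′} → M ⇝ M′ → letpair V M ⇝ letpair V M′
      caseV    : ∀ {n} {V V′ : Val n} {bs} → V ⇝v V′ → case V bs ⇝ case V′ bs
      caseB    : ∀ {n} {V : Val n} {bs bs′} → bs ⇝b bs′ → case V bs ⇝ case V bs′
      forceV   : ∀ {n} {V V′ : Val n} → V ⇝v V′ → force V ⇝ force V′
      returnV  : ∀ {n} {V V′ : Val n} → V ⇝v V′ → return V ⇝ return V′
      letbindM : ∀ {n} {M M′ : Comp n} {N} → M ⇝ M′ → letbind M N ⇝ letbind M′ N
      letbindN : ∀ {n} {M : Comp n} {N N′} → N ⇝ N′ → letbind M N ⇝ letbind M N′
      lamM     : ∀ {n} {M M′ : Comp (suc n)} → M ⇝ M′ → lam M ⇝ lam M′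
      appM     : ∀ {n} {M M′ : Comp n} {V} → M ⇝ M′ → app M V ⇝ app M′ V
      appV     : ∀ {n} {M : Comp n} {V V′} → V ⇝v V′ → app M V ⇝ app M V′
      cpair₁   : ∀ {n} {M M′ N : Comp n} → M ⇝ M′ → cpair M N ⇝ cpair M′ N
      cpair₂   : ∀ {n} {M N N′ : Comp n} → N ⇝ N′ → cpair M N ⇝ cpair M N′
      prj₁M    : ∀ {n} {M M′ : Comp n} → M ⇝ M′ → prj₁ M ⇝ prj₁ M′
      prj₂M    : ∀ {n} {M M′ : Comp n} → M ⇝ M′ → prj₂ M ⇝ prj₂ M′
      shift0M  : ∀ {n} {M M′ : Comp (suc n)} → M ⇝ M′ → shift0 M ⇝ shift0 M′
      handleM  : ∀ {n} {M M′ : Comp n} {N} → M ⇝ M′ → handle M N ⇝ handle M′ N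
      handleN  : ∀ {n} {M : Comp n} {N N′} → N ⇝ N′ → handle M N ⇝ handle M N′

    data _⇝v_ : ∀ {n} → Val n → Val n → Set where
      pair₁  : ∀ {n} {V V′ W : Val n} → V ⇝v V′ → pair V W ⇝v pair V′ W
      pair₂  : ∀ {n} {V W W′ : Val n} → W ⇝v W′ → pair V W ⇝v pair V W′
      injV   : ∀ {n} {l} {V V′ : Val n} → V ⇝v V′ → inj l V ⇝v inj l V′
      thunkM : ∀ {n} {M M′ : Comp n} → M ⇝ M′ → thunk M ⇝v thunk M′

    data _⇝b_ : ∀ {n} → Branches n → Branches n → Set where
      headB : ∀ {n} {l} {M M′ : Comp (suc n)} {bs} → M ⇝ M′ → (l ↦ M ∷ bs) ⇝b (l ↦ M′ ∷ bs)
      tailB : ∀ {n} {l} {M : Comp (suc n)} {bs bs′} → bs ⇝b bs′ → (l ↦ M ∷ bs) ⇝b (l ↦ M ∷ bs′)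

  _⇝⁺_ : ∀ {n} → Comp n → Comp n → Set
  _⇝⁺_ = TransClosure _⇝_

mutual
  trV : ∀ {n} → MR.Val n → DC.Val n
  trV (MR.var i)    = DC.var i
  trV MR.unit       = DC.unit
  trV (MR.pair V W) = DC.pair (trV V) (trV W)
  trV (MR.inj l V)  = DC.inj l (trV V)
  trV (MR.thunk M)  = DC.thunk (trC M)

  trC : ∀ {n} → MR.Comp n → DC.Comp n
  trC (MR.letpair V M) = DC.letpair (trV V) (trC M)
  trC (MR.case V bs)   = DC.case (trV V) (trB bs)
  trC (MR.force V)     = DC.force (trV V)
  trC (MR.return V)    = DC.return (trV V)
  trC (MR.letbind M N) = DC.letbind (trC M) (trC N)
  trC (MR.lam M)       = DC.lam (trC M)
  trC (MR.app M V)     = DC.app (trC M) (trV V)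
  trC (MR.cpair M N)   = DC.cpair (trC M) (trC N)
  trC (MR.prj₁ M)      = DC.prj₁ (trC M)
  trC (MR.prj₂ M)      = DC.prj₂ (trC M)
  -- (reflect M)* = S₀k. λb. b! ({M*}, {λx. k! x b})
  --   under S₀k, λb : b = 0, k = 1 ; under λx additionally : x = 0, b = 1, k = 2
  trC (MR.reflect M)   =
    DC.shift0 (DC.lam
      (DC.app (DC.force (DC.var zero))
              (DC.pair (DC.thunk (DC.renC (λ i → suc (suc i)) (trC M)))
                       (DC.thunk (DC.lam
                          (DC.app (DC.app (DC.force (DC.var (suc (suc zero))))
                                          (DC.var zero))
                                  (DC.var (suc zero))))))))
  -- (reify_T M)* = ⟨M* | x. λb. Nu*⟩ {λ(y,f). Nb*}
  --   λ(y,f).P = λw. let (y,f) = w in P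
  trC (MR.reify (MR.where' Nu Nb) M) =
    DC.app (DC.handle (trC M) (DC.lam (DC.renC suc (trC Nu))))
           (DC.thunk (DC.lam (DC.letpair (DC.var zero)
                        (DC.renC (DC.liftR (DC.liftR suc)) (trC Nb)))))

  trB : ∀ {n} → MR.Branches n → DC.Branches n
  trB MR.[]             = DC.[]
  trB (l MR.↦ M ∷ bs)   = l DC.↦ trC M ∷ trB bs

-- Each monadic-reflection redex is mirrored by a short, fixed sequence of
-- delimited-control redexes.  The translated reify installs the handler
-- ⟨M* | x.λb.Nu*⟩ and passes the bind operation λ(y,f).Nb* to it as the extra
-- argument b.  A translated reflect captures the delimited continuation k with S₀
-- and calls b on the reflected computation and on λx. k! x b; forcing k
-- re-installs the same handler around the hoisting context, which is exactly the
-- reified continuation λz. reify_T H[return z] of the reify/reflect β-rule.  All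
-- other rules are matched one-for-one, using that the translation commutes with
-- substitution, and ⇝ is closed under the translated evaluation contexts.

module Submission where

open import Data.Nat using (ℕ; zero; suc)
open import Data.Fin using (zero; suc)
open import Relation.Binary.PropositionalEquality
open import Relation.Binary.Construct.Closure.Transitive using ([_]; _∷_; _++_)
open import Function using (_∘_)
open import Defs
open DC

private
  variable
    k m m′ n : ℕ

cong₃ : ∀ {A B C D : Set} (f : A → B → C → D) {x x′ y y′ z z′} →
        x ≡ x′ → y ≡ y′ → z ≡ z′ → f x y z ≡ f x′ y′ z′
cong₃ f refl refl refl = refl

infixl 3 _⟫_
_⟫_ : {M N N′ : Comp n} → M ⇝⁺ N → N ≡ N′ → M ⇝⁺ N′
p ⟫ refl = p

map⁺ : {f : Comp m → Comp n} → (∀ {M N} → M ⇝ N → f M ⇝ f N) → ∀ {M N} → M ⇝⁺ N → f M ⇝⁺ f N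
map⁺ g [ s ]    = [ g s ]
map⁺ g (s ∷ ss) = g s ∷ map⁺ g ss

liftR-id : {ρ : Ren n n} → (∀ i → ρ i ≡ i) → ∀ i → liftR ρ i ≡ i
liftR-id e zero    = refl
liftR-id e (suc i) = cong suc (e i)

mutual
  renV-id : {ρ : Ren n n} → (∀ i → ρ i ≡ i) → ∀ V → renV ρ V ≡ V
  renV-id e (var i)    = cong var (e i)
  renV-id e unit       = refl
  renV-id e (pair V W) = cong₂ pair (renV-id e V) (renV-id e W)
  renV-id e (inj l V)  = cong (inj l) (renV-id e V)
  renV-id e (thunk M)  = cong thunk (renC-id e M)

  renC-id : {ρ : Ren n n} → (∀ i → ρ i ≡ i) → ∀ M → renC ρ M ≡ M
  renC-id e (letpair V M) = cong₂ letpair (renV-id e V) (renC-id (liftR-id (liftR-id e)) M)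
  renC-id e (case V bs)   = cong₂ case (renV-id e V) (renB-id e bs)
  renC-id e (force V)     = cong force (renV-id e V)
  renC-id e (return V)    = cong return (renV-id e V)
  renC-id e (letbind M N) = cong₂ letbind (renC-id e M) (renC-id (liftR-id e) N)
  renC-id e (lam M)       = cong lam (renC-id (liftR-id e) M)
  renC-id e (app M V)     = cong₂ app (renC-id e M) (renV-id e V)
  renC-id e (cpair M N)   = cong₂ cpair (renC-id e M) (renC-id e N)
  renC-id e (prj₁ M)      = cong prj₁ (renC-id e M)
  renC-id e (prj₂ M)      = cong prj₂ (renC-id e M)
  renC-id e (shift0 M)    = cong shift0 (renC-id (liftR-id e) M)
  renC-id e (handle M N)  = cong₂ handle (renC-id e M) (renC-id (liftR-id e) N)

  renB-id : {ρ : Ren n n} → (∀ i → ρ i ≡ i) → ∀ bs → renB ρ bs ≡ bs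
  renB-id e []           = refl
  renB-id e (l ↦ M ∷ bs) = cong₂ (l ↦_∷_) (renC-id (liftR-id e) M) (renB-id e bs)

liftR-∘ : {ρ : Ren m n} {ρ′ : Ren k m} {χ : Ren k n} →
          (∀ i → ρ (ρ′ i) ≡ χ i) → ∀ i → liftR ρ (liftR ρ′ i) ≡ liftR χ i
liftR-∘ e zero    = refl
liftR-∘ e (suc i) = cong suc (e i)

mutual
  renV-renV : {ρ : Ren m n} {ρ′ : Ren k m} {χ : Ren k n} →
              (∀ i → ρ (ρ′ i) ≡ χ i) → ∀ V → renV ρ (renV ρ′ V) ≡ renV χ V
  renV-renV e (var i)    = cong var (e i)
  renV-renV e unit       = refl
  renV-renV e (pair V W) = cong₂ pair (renV-renV e V) (renV-renV e W)
  renV-renV e (inj l V)  = cong (inj l) (renV-renV e V)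
  renV-renV e (thunk M)  = cong thunk (renC-renC e M)

  renC-renC : {ρ : Ren m n} {ρ′ : Ren k m} {χ : Ren k n} →
              (∀ i → ρ (ρ′ i) ≡ χ i) → ∀ M → renC ρ (renC ρ′ M) ≡ renC χ M
  renC-renC e (letpair V M) = cong₂ letpair (renV-renV e V) (renC-renC (liftR-∘ (liftR-∘ e)) M)
  renC-renC e (case V bs)   = cong₂ case (renV-renV e V) (renB-renB e bs)
  renC-renC e (force V)     = cong force (renV-renV e V)
  renC-renC e (return V)    = cong return (renV-renV e V)
  renC-renC e (letbind M N) = cong₂ letbind (renC-renC e M) (renC-renC (liftR-∘ e) N)
  renC-renC e (lam M)       = cong lam (renC-renC (liftR-∘ e) M)
  renC-renC e (app M V)     = cong₂ app (renC-renC e M) (renV-renV e V)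
  renC-renC e (cpair M N)   = cong₂ cpair (renC-renC e M) (renC-renC e N)
  renC-renC e (prj₁ M)      = cong prj₁ (renC-renC e M)
  renC-renC e (prj₂ M)      = cong prj₂ (renC-renC e M)
  renC-renC e (shift0 M)    = cong shift0 (renC-renC (liftR-∘ e) M)
  renC-renC e (handle M N)  = cong₂ handle (renC-renC e M) (renC-renC (liftR-∘ e) N)

  renB-renB : {ρ : Ren m n} {ρ′ : Ren k m} {χ : Ren k n} →
              (∀ i → ρ (ρ′ i) ≡ χ i) → ∀ bs → renB ρ (renB ρ′ bs) ≡ renB χ bs
  renB-renB e []           = refl
  renB-renB e (l ↦ M ∷ bs) = cong₂ (l ↦_∷_) (renC-renC (liftR-∘ e) M) (renB-renB e bs)

renV-renV-commute : {ρ₁ : Ren m n} {ρ₂ : Ren k m} {ρ₃ : Ren m′ n} {ρ₄ : Ren k m′} →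
                    (∀ i → ρ₁ (ρ₂ i) ≡ ρ₃ (ρ₄ i)) → ∀ V → renV ρ₁ (renV ρ₂ V) ≡ renV ρ₃ (renV ρ₄ V)
renV-renV-commute e V = trans (renV-renV e V) (sym (renV-renV (λ _ → refl) V))

renC-renC-commute : {ρ₁ : Ren m n} {ρ₂ : Ren k m} {ρ₃ : Ren m′ n} {ρ₄ : Ren k m′} →
                    (∀ i → ρ₁ (ρ₂ i) ≡ ρ₃ (ρ₄ i)) → ∀ M → renC ρ₁ (renC ρ₂ M) ≡ renC ρ₃ (renC ρ₄ M)
renC-renC-commute e M = trans (renC-renC e M) (sym (renC-renC (λ _ → refl) M))

liftS-liftR : {σ : Sub m n} {ρ : Ren k m} {χ : Ren k n} →
              (∀ i → σ (ρ i) ≡ var (χ i)) → ∀ i → liftS σ (liftR ρ i) ≡ var (liftR χ i)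
liftS-liftR e zero    = refl
liftS-liftR e (suc i) = cong (renV suc) (e i)

mutual
  subV-renV : {σ : Sub m n} {ρ : Ren k m} {χ : Ren k n} →
              (∀ i → σ (ρ i) ≡ var (χ i)) → ∀ V → subV σ (renV ρ V) ≡ renV χ V
  subV-renV e (var i)    = e i
  subV-renV e unit       = refl
  subV-renV e (pair V W) = cong₂ pair (subV-renV e V) (subV-renV e W)
  subV-renV e (inj l V)  = cong (inj l) (subV-renV e V)
  subV-renV e (thunk M)  = cong thunk (subC-renC e M)

  subC-renC : {σ : Sub m n} {ρ : Ren k m} {χ : Ren k n} →
              (∀ i → σ (ρ i) ≡ var (χ i)) → ∀ M → subC σ (renC ρ M) ≡ renC χ M
  subC-renC e (letpair V M) = cong₂ letpair (subV-renV e V) (subC-renC (liftS-liftR (liftS-liftR e)) M)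
  subC-renC e (case V bs)   = cong₂ case (subV-renV e V) (subB-renB e bs)
  subC-renC e (force V)     = cong force (subV-renV e V)
  subC-renC e (return V)    = cong return (subV-renV e V)
  subC-renC e (letbind M N) = cong₂ letbind (subC-renC e M) (subC-renC (liftS-liftR e) N)
  subC-renC e (lam M)       = cong lam (subC-renC (liftS-liftR e) M)
  subC-renC e (app M V)     = cong₂ app (subC-renC e M) (subV-renV e V)
  subC-renC e (cpair M N)   = cong₂ cpair (subC-renC e M) (subC-renC e N)
  subC-renC e (prj₁ M)      = cong prj₁ (subC-renC e M)
  subC-renC e (prj₂ M)      = cong prj₂ (subC-renC e M)
  subC-renC e (shift0 M)    = cong shift0 (subC-renC (liftS-liftR e) M)
  subC-renC e (handle M N)  = cong₂ handle (subC-renC e M) (subC-renC (liftS-liftR e) N)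

  subB-renB : {σ : Sub m n} {ρ : Ren k m} {χ : Ren k n} →
              (∀ i → σ (ρ i) ≡ var (χ i)) → ∀ bs → subB σ (renB ρ bs) ≡ renB χ bs
  subB-renB e []           = refl
  subB-renB e (l ↦ M ∷ bs) = cong₂ (l ↦_∷_) (subC-renC (liftS-liftR e) M) (subB-renB e bs)

subC-renC-cancel : {σ : Sub m n} {ρ : Ren n m} →
                   (∀ i → σ (ρ i) ≡ var i) → ∀ M → subC σ (renC ρ M) ≡ M
subC-renC-cancel e M = trans (subC-renC e M) (renC-id (λ _ → refl) M)

liftR-liftS : {ρ : Ren m n} {σ : Sub k m} {τ : Sub m′ n} {ρ′ : Ren k m′} →
              (∀ i → renV ρ (σ i) ≡ τ (ρ′ i)) →
              ∀ i → renV (liftR ρ) (liftS σ i) ≡ liftS τ (liftR ρ′ i)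
liftR-liftS e zero    = refl
liftR-liftS e (suc i) = trans (renV-renV-commute (λ _ → refl) _) (cong (renV suc) (e i))

mutual
  renV-subV : {ρ : Ren m n} {σ : Sub k m} {τ : Sub m′ n} {ρ′ : Ren k m′} →
              (∀ i → renV ρ (σ i) ≡ τ (ρ′ i)) → ∀ V → renV ρ (subV σ V) ≡ subV τ (renV ρ′ V)
  renV-subV e (var i)    = e i
  renV-subV e unit       = refl
  renV-subV e (pair V W) = cong₂ pair (renV-subV e V) (renV-subV e W)
  renV-subV e (inj l V)  = cong (inj l) (renV-subV e V)
  renV-subV e (thunk M)  = cong thunk (renC-subC e M)

  renC-subC : {ρ : Ren m n} {σ : Sub k m} {τ : Sub m′ n} {ρ′ : Ren k m′} →
              (∀ i → renV ρ (σ i) ≡ τ (ρ′ i)) → ∀ M → renC ρ (subC σ M) ≡ subC τ (renC ρ′ M)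
  renC-subC e (letpair V M) = cong₂ letpair (renV-subV e V) (renC-subC (liftR-liftS (liftR-liftS e)) M)
  renC-subC e (case V bs)   = cong₂ case (renV-subV e V) (renB-subB e bs)
  renC-subC e (force V)     = cong force (renV-subV e V)
  renC-subC e (return V)    = cong return (renV-subV e V)
  renC-subC e (letbind M N) = cong₂ letbind (renC-subC e M) (renC-subC (liftR-liftS e) N)
  renC-subC e (lam M)       = cong lam (renC-subC (liftR-liftS e) M)
  renC-subC e (app M V)     = cong₂ app (renC-subC e M) (renV-subV e V)
  renC-subC e (cpair M N)   = cong₂ cpair (renC-subC e M) (renC-subC e N)
  renC-subC e (prj₁ M)      = cong prj₁ (renC-subC e M)
  renC-subC e (prj₂ M)      = cong prj₂ (renC-subC e M)
  renC-subC e (shift0 M)    = cong shift0 (renC-subC (liftR-liftS e) M)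
  renC-subC e (handle M N)  = cong₂ handle (renC-subC e M) (renC-subC (liftR-liftS e) N)

  renB-subB : {ρ : Ren m n} {σ : Sub k m} {τ : Sub m′ n} {ρ′ : Ren k m′} →
              (∀ i → renV ρ (σ i) ≡ τ (ρ′ i)) → ∀ bs → renB ρ (subB σ bs) ≡ subB τ (renB ρ′ bs)
  renB-subB e []           = refl
  renB-subB e (l ↦ M ∷ bs) = cong₂ (l ↦_∷_) (renC-subC (liftR-liftS e) M) (renB-subB e bs)

-- S₀k.λb. b!({Q}, {λx. k! x b}), where b and k are variables zero and one of Q.
reflectWith : Comp (suc (suc n)) → Comp n
reflectWith Q =
  shift0 (lam (app (force (var zero))
    (pair (thunk Q) (thunk (lam (app (app (force (var (suc (suc zero)))) (var zero)) (var (suc zero))))))))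

-- λ(y,f).B, i.e. λw. let (y,f) = w in B, so that f, y, w are variables 0, 1, 2 of B.
lamPair : Comp (suc (suc (suc n))) → Val n
lamPair B = thunk (lam (letpair (var zero) B))

-- ⟨M | x.λb.U⟩ {λ(y,f).B}, where b and x are variables zero and one of U.
reifyWith : Comp (suc (suc n)) → Comp (suc (suc (suc n))) → Comp n → Comp n
reifyWith U B M = app (handle M (lam U)) (lamPair B)

reflectWith-handled : ∀ (H : Hoist n) (P : Comp n) (L : Comp (suc n)) (F : Val n) →
  app (handle (plugH H (reflectWith (renC (λ i → suc (suc i)) P))) L) F ⇝⁺
  app (force F) (pair (thunk P)
    (thunk (lam (app (handle (plugH (renH suc H) (return (var zero))) (renC (liftR suc) L)) (renV suc F)))))
reflectWith-handled H P L F =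
  appM (β (β-hdlS H)) ∷ β β-lam ∷
  appV (pair₂ (thunkM (lamM (appM (appM (β β-force)))))) ∷
  [ appV (pair₂ (thunkM (lamM (appM (β β-lam))))) ]
  ⟫ cong₂ (λ P′ X → app (force F) (pair (thunk P′) (thunk (lam (app X (renV suc F))))))
          computation≡ (continuation≡ (handle (plugH (renH suc H) (return (var zero))) (renC (liftR suc) L)))
  where
  computation≡ : ∀ {K} → subC (sub1 F) (subC (liftS (sub1 K)) (renC (λ i → suc (suc i)) P)) ≡ P
  computation≡ = trans (cong (subC (sub1 F)) (subC-renC {χ = suc} (λ _ → refl) P))
                       (subC-renC-cancel (λ _ → refl) P)

  continuation≡ : ∀ X → subC (sub1 (var zero))
                          (subC (liftS (liftS (sub1 F))) (renC (liftR suc) (renC (liftR suc) X))) ≡ X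
  continuation≡ X = begin
      subC (sub1 (var zero)) (subC (liftS (liftS (sub1 F))) (renC (liftR suc) (renC (liftR suc) X)))
    ≡⟨ cong (subC (sub1 (var zero)) ∘ subC (liftS (liftS (sub1 F))))
            (renC-renC {χ = liftR (λ i → suc (suc i))} (liftR-∘ (λ _ → refl)) X) ⟩
      subC (sub1 (var zero)) (subC (liftS (liftS (sub1 F))) (renC (liftR (λ i → suc (suc i))) X))
    ≡⟨ cong (subC (sub1 (var zero))) (subC-renC {χ = liftR suc} (liftS-liftR (λ _ → refl)) X) ⟩
      subC (sub1 (var zero)) (renC (liftR suc) X)
    ≡⟨ subC-renC-cancel (λ { zero → refl ; (suc i) → refl }) X ⟩
      X ∎
    where open ≡-Reasoning

lamPair-pair : ∀ (Q : Comp (suc (suc n))) V W →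
  app (force (lamPair (renC (liftR (liftR suc)) Q))) (pair V W) ⇝⁺ Q [ V , W ]₂
lamPair-pair Q V W =
  appM (β β-force) ∷ β β-lam ∷ [ β β-let ]
  ⟫ cong (subC (sub2 V W))
         (subC-renC-cancel (λ { zero → refl ; (suc zero) → refl ; (suc (suc i)) → refl }) Q)

reifyWith-reflectWith : ∀ (H : Hoist n) P U (Q : Comp (suc (suc n))) →
  reifyWith U (renC (liftR (liftR suc)) Q) (plugH H (reflectWith (renC (λ i → suc (suc i)) P))) ⇝⁺
  Q [ thunk P
    , thunk (lam (reifyWith (renC (liftR (liftR suc)) U) (renC (liftR (liftR (liftR suc))) (renC (liftR (liftR suc)) Q))
                            (plugH (renH suc H) (return (var zero))))) ]₂
reifyWith-reflectWith H P U Q = reflectWith-handled H P (lam U) _ ++ lamPair-pair Q _ _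

-- (reify_T M)* = reifyWith (retClause T) (bindClause T) M*.
retClause : MR.Monad n → Comp (suc (suc n))
retClause (MR.where' Nu Nb) = renC suc (trC Nu)

bindClause : MR.Monad n → Comp (suc (suc (suc n)))
bindClause (MR.where' Nu Nb) = renC (liftR (liftR suc)) (trC Nb)

MR-liftR≗liftR : {ρ ρ′ : Ren m n} → (∀ i → ρ i ≡ ρ′ i) → ∀ i → MR.liftR ρ i ≡ liftR ρ′ i
MR-liftR≗liftR e zero    = refl
MR-liftR≗liftR e (suc i) = cong suc (e i)

mutual
  trV-renV : {ρ ρ′ : Ren m n} → (∀ i → ρ i ≡ ρ′ i) → ∀ V → trV (MR.renV ρ V) ≡ renV ρ′ (trV V)
  trV-renV e (MR.var i)    = cong var (e i)
  trV-renV e MR.unit       = refl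
  trV-renV e (MR.pair V W) = cong₂ pair (trV-renV e V) (trV-renV e W)
  trV-renV e (MR.inj l V)  = cong (inj l) (trV-renV e V)
  trV-renV e (MR.thunk M)  = cong thunk (trC-renC e M)

  trC-renC : {ρ ρ′ : Ren m n} → (∀ i → ρ i ≡ ρ′ i) → ∀ M → trC (MR.renC ρ M) ≡ renC ρ′ (trC M)
  trC-renC e (MR.letpair V M) = cong₂ letpair (trV-renV e V) (trC-renC (MR-liftR≗liftR (MR-liftR≗liftR e)) M)
  trC-renC e (MR.case V bs)   = cong₂ case (trV-renV e V) (trB-renB e bs)
  trC-renC e (MR.force V)     = cong force (trV-renV e V)
  trC-renC e (MR.return V)    = cong return (trV-renV e V)
  trC-renC e (MR.letbind M N) = cong₂ letbind (trC-renC e M) (trC-renC (MR-liftR≗liftR e) N)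
  trC-renC e (MR.lam M)       = cong lam (trC-renC (MR-liftR≗liftR e) M)
  trC-renC e (MR.app M V)     = cong₂ app (trC-renC e M) (trV-renV e V)
  trC-renC e (MR.cpair M N)   = cong₂ cpair (trC-renC e M) (trC-renC e N)
  trC-renC e (MR.prj₁ M)      = cong prj₁ (trC-renC e M)
  trC-renC e (MR.prj₂ M)      = cong prj₂ (trC-renC e M)
  trC-renC e (MR.reflect M)   =
    cong reflectWith (trans (cong (renC _) (trC-renC e M)) (renC-renC-commute (λ _ → refl) (trC M)))
  trC-renC e (MR.reify T@(MR.where' _ _) M) =
    cong₃ reifyWith (retClause-renT e T) (bindClause-renT e T) (trC-renC e M)

  trB-renB : {ρ ρ′ : Ren m n} → (∀ i → ρ i ≡ ρ′ i) → ∀ bs → trB (MR.renB ρ bs) ≡ renB ρ′ (trB bs)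
  trB-renB e MR.[]           = refl
  trB-renB e (l MR.↦ M ∷ bs) = cong₂ (l ↦_∷_) (trC-renC (MR-liftR≗liftR e) M) (trB-renB e bs)

  retClause-renT : {ρ ρ′ : Ren m n} → (∀ i → ρ i ≡ ρ′ i) →
                   ∀ T → retClause (MR.renT ρ T) ≡ renC (liftR (liftR ρ′)) (retClause T)
  retClause-renT e (MR.where' Nu Nb) =
    trans (cong (renC suc) (trC-renC (MR-liftR≗liftR e) Nu)) (renC-renC-commute (λ _ → refl) (trC Nu))

  bindClause-renT : {ρ ρ′ : Ren m n} → (∀ i → ρ i ≡ ρ′ i) →
                    ∀ T → bindClause (MR.renT ρ T) ≡ renC (liftR (liftR (liftR ρ′))) (bindClause T)
  bindClause-renT e (MR.where' Nu Nb) =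
    trans (cong (renC _) (trC-renC (MR-liftR≗liftR (MR-liftR≗liftR e)) Nb))
          (renC-renC-commute (λ { zero → refl ; (suc zero) → refl ; (suc (suc i)) → refl }) (trC Nb))

trV-liftS : {σ : MR.Sub m n} {τ : Sub m n} → (∀ i → trV (σ i) ≡ τ i) → ∀ i → trV (MR.liftS σ i) ≡ liftS τ i
trV-liftS e zero    = refl
trV-liftS e (suc i) = trans (trV-renV (λ _ → refl) _) (cong (renV suc) (e i))

mutual
  trV-subV : {σ : MR.Sub m n} {τ : Sub m n} → (∀ i → trV (σ i) ≡ τ i) → ∀ V → trV (MR.subV σ V) ≡ subV τ (trV V)
  trV-subV e (MR.var i)    = e i
  trV-subV e MR.unit       = refl
  trV-subV e (MR.pair V W) = cong₂ pair (trV-subV e V) (trV-subV e W)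
  trV-subV e (MR.inj l V)  = cong (inj l) (trV-subV e V)
  trV-subV e (MR.thunk M)  = cong thunk (trC-subC e M)

  trC-subC : {σ : MR.Sub m n} {τ : Sub m n} → (∀ i → trV (σ i) ≡ τ i) → ∀ M → trC (MR.subC σ M) ≡ subC τ (trC M)
  trC-subC e (MR.letpair V M) = cong₂ letpair (trV-subV e V) (trC-subC (trV-liftS (trV-liftS e)) M)
  trC-subC e (MR.case V bs)   = cong₂ case (trV-subV e V) (trB-subB e bs)
  trC-subC e (MR.force V)     = cong force (trV-subV e V)
  trC-subC e (MR.return V)    = cong return (trV-subV e V)
  trC-subC e (MR.letbind M N) = cong₂ letbind (trC-subC e M) (trC-subC (trV-liftS e) N)
  trC-subC e (MR.lam M)       = cong lam (trC-subC (trV-liftS e) M)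
  trC-subC e (MR.app M V)     = cong₂ app (trC-subC e M) (trV-subV e V)
  trC-subC e (MR.cpair M N)   = cong₂ cpair (trC-subC e M) (trC-subC e N)
  trC-subC e (MR.prj₁ M)      = cong prj₁ (trC-subC e M)
  trC-subC e (MR.prj₂ M)      = cong prj₂ (trC-subC e M)
  trC-subC {τ = τ} e (MR.reflect M) =
    cong reflectWith (trans (cong (renC _) (trC-subC e M))
                            (renC-subC (λ i → sym (renV-renV (λ _ → refl) (τ i))) (trC M)))
  trC-subC e (MR.reify T@(MR.where' _ _) M) =
    cong₃ reifyWith (retClause-subT e T) (bindClause-subT e T) (trC-subC e M)

  trB-subB : {σ : MR.Sub m n} {τ : Sub m n} → (∀ i → trV (σ i) ≡ τ i) → ∀ bs → trB (MR.subB σ bs) ≡ subB τ (trB bs)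
  trB-subB e MR.[]           = refl
  trB-subB e (l MR.↦ M ∷ bs) = cong₂ (l ↦_∷_) (trC-subC (trV-liftS e) M) (trB-subB e bs)

  retClause-subT : {σ : MR.Sub m n} {τ : Sub m n} → (∀ i → trV (σ i) ≡ τ i) →
                   ∀ T → retClause (MR.subT σ T) ≡ subC (liftS (liftS τ)) (retClause T)
  retClause-subT e (MR.where' Nu Nb) =
    trans (cong (renC suc) (trC-subC (trV-liftS e) Nu)) (renC-subC (λ _ → refl) (trC Nu))

  bindClause-subT : {σ : MR.Sub m n} {τ : Sub m n} → (∀ i → trV (σ i) ≡ τ i) →
                    ∀ T → bindClause (MR.subT σ T) ≡ subC (liftS (liftS (liftS τ))) (bindClause T)
  bindClause-subT e (MR.where' Nu Nb) =
    trans (cong (renC _) (trC-subC (trV-liftS (trV-liftS e)) Nb))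
          (renC-subC (liftR-liftS (liftR-liftS (λ _ → refl))) (trC Nb))

trC-[]₁ : ∀ (M : MR.Comp (suc n)) V → trC (M MR.[ V ]₁) ≡ trC M [ trV V ]₁
trC-[]₁ M V = trC-subC (λ { zero → refl ; (suc i) → refl }) M

trC-[,]₂ : ∀ (M : MR.Comp (suc (suc n))) V W → trC (M MR.[ V , W ]₂) ≡ trC M [ trV V , trV W ]₂
trC-[,]₂ M V W = trC-subC (λ { zero → refl ; (suc zero) → refl ; (suc (suc i)) → refl }) M

trB-∋ : ∀ {bs : MR.Branches n} {l M} → bs MR.∋ l ↦ M → trB bs ∋ l ↦ trC M
trB-∋ MR.here         = here
trB-∋ (MR.there l≢ p) = there l≢ (trB-∋ p)

trF : MR.Frame n → Frame n
trF (MR.letF N) = letF (trC N)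
trF (MR.appF V) = appF (trV V)
trF MR.prj₁F    = prj₁F
trF MR.prj₂F    = prj₂F

trH : MR.Hoist n → Hoist n
trH MR.hole    = hole
trH (H MR.▷ B) = trH H ▷ trF B

trC-plugF : ∀ (B : MR.Frame n) M → trC (MR.plugF B M) ≡ plugF (trF B) (trC M)
trC-plugF (MR.letF N) M = refl
trC-plugF (MR.appF V) M = refl
trC-plugF MR.prj₁F    M = refl
trC-plugF MR.prj₂F    M = refl

trC-plugH : ∀ (H : MR.Hoist n) M → trC (MR.plugH H M) ≡ plugH (trH H) (trC M)
trC-plugH MR.hole    M = refl
trC-plugH (H MR.▷ B) M = trans (trC-plugH H (MR.plugF B M)) (cong (plugH (trH H)) (trC-plugF B M))

trF-renF : ∀ (ρ : Ren m n) B → trF (MR.renF ρ B) ≡ renF ρ (trF B)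
trF-renF ρ (MR.letF N) = cong letF (trC-renC (MR-liftR≗liftR (λ _ → refl)) N)
trF-renF ρ (MR.appF V) = cong appF (trV-renV (λ _ → refl) V)
trF-renF ρ MR.prj₁F    = refl
trF-renF ρ MR.prj₂F    = refl

trH-renH : ∀ (ρ : Ren m n) H → trH (MR.renH ρ H) ≡ renH ρ (trH H)
trH-renH ρ MR.hole    = refl
trH-renH ρ (H MR.▷ B) = cong₂ _▷_ (trH-renH ρ H) (trF-renF ρ B)

simulate-→β : {M N : MR.Comp n} → M MR.→β N → trC M ⇝⁺ trC N
simulate-→β (MR.β-let {V₁} {V₂} {M}) = [ β β-let ] ⟫ sym (trC-[,]₂ M V₁ V₂)
simulate-→β (MR.β-case {V = V} {M = M} p) = [ β (β-case (trB-∋ p)) ] ⟫ sym (trC-[]₁ M V)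
simulate-→β MR.β-force = [ β β-force ]
simulate-→β (MR.β-ret {V} {N}) = [ β β-ret ] ⟫ sym (trC-[]₁ N V)
simulate-→β (MR.β-lam {M} {V}) = [ β β-lam ] ⟫ sym (trC-[]₁ M V)
simulate-→β MR.β-prj₁ = [ β β-prj₁ ]
simulate-→β MR.β-prj₂ = [ β β-prj₂ ]
simulate-→β (MR.β-reifyR {Nu} {Nb} {V}) =
  appM (β β-hdlR) ∷ [ β β-lam ] ⟫
    trans (cong (subC (sub1 _)) (sym (renC-subC (λ _ → refl) (trC Nu))))
          (trans (subC-renC-cancel (λ _ → refl) _) (sym (trC-[]₁ Nu V)))
simulate-→β (MR.β-reifyS {Nu} {Nb} H {N}) =
  subst₂ _⇝⁺_ (cong (reifyWith _ _) (sym (trC-plugH H (MR.reflect N))))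
               (sym (trans (trC-[,]₂ Nb _ _) (cong (λ R → trC Nb [ thunk (trC N) , thunk (lam R) ]₂) continuation≡)))
               (reifyWith-reflectWith (trH H) (trC N) (renC suc (trC Nu)) (trC Nb))
  where
  T = MR.where' Nu Nb
  continuation≡ : trC (MR.reify (MR.renT suc T) (MR.plugH (MR.renH suc H) (MR.return (MR.var zero)))) ≡
                  reifyWith (renC (liftR (liftR suc)) (retClause T)) (renC (liftR (liftR (liftR suc))) (bindClause T))
                            (plugH (renH suc (trH H)) (return (var zero)))
  continuation≡ =
    cong₃ reifyWith (retClause-renT (λ _ → refl) T) (bindClause-renT (λ _ → refl) T)
          (trans (trC-plugH (MR.renH suc H) _) (cong (λ G → plugH G (return (var zero))) (trH-renH suc H)))

simulate-K : ∀ (K : MR.ECtx n) {M N} → trC M ⇝⁺ trC N → trC (MR.plugK K M) ⇝⁺ trC (MR.plugK K N)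
simulate-K MR.hole                    p = p
simulate-K (K MR.▷ MR.letF _)         p = simulate-K K (map⁺ letbindM p)
simulate-K (K MR.▷ MR.appF _)         p = simulate-K K (map⁺ appM p)
simulate-K (K MR.▷ MR.prj₁F)          p = simulate-K K (map⁺ prj₁M p)
simulate-K (K MR.▷ MR.prj₂F)          p = simulate-K K (map⁺ prj₂M p)
simulate-K (K MR.▷rf MR.where' _ _)   p = simulate-K K (map⁺ (appM ∘ handleM) p)

theorem6p5 : ∀ {n} (M N : MR.Comp n) → M MR.⟶ N → trC M DC.⇝⁺ trC N
theorem6p5 _ _ (MR.step K s) = simulate-K K (simulate-→β s)
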